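{- Let $G$ be a triangle-free $d$-regular graph with $d\ge7$, and let $k\ge2$. Then $G^{(k)}=G\boxtimes K_k$ does not contain a topological minor of $K_t$ for $t=kd+2$.
   Context: The strong product $G_1\boxtimes G_2$ is the graph on $V(G_1)\times V(G_2)$ in which $(u_1,u_2)$ is adjacent to $(v_1,v_2)$ iff either $u_1=v_1$ and $u_2v_2\in E(G_2)$, or $u_2=v_2$ and $u_1v_1\in E(G_1)$, or $u_1v_1\in E(G_1)$ and $u_2v_2\in E(G_2)$. $G^{(k)}$ denotes $G\boxtimes K_k$. A graph $H$ is a topological minor of $G$ if some subdivision of $H$ (obtained by replacing edges of $H$ by internally vertex-disjoint paths) is a subgraph of $G$. -}

module Defs where

open import Level using (0ℓ)
open import Data.Nat using (ℕ; _≤_)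
open import Data.Fin using (Fin; _<_)
open import Data.Product using (_×_; _,_)
open import Data.Sum using (_⊎_; inj₁; inj₂)
open import Data.Empty using (⊥)
open import Data.List using (List; []; _∷_; _++_)
open import Data.List.Membership.Propositional using (_∈_)
open import Data.List.Relation.Unary.Linked using (Linked)
open import Data.List.Relation.Unary.Unique.Propositional using (Unique)
open import Data.Vec using (count; allFin)
open import Relation.Nullary using (¬_; Dec)
open import Relation.Binary using (Decidable)
open import Relation.Binary.PropositionalEquality using (_≡_; _≢_; refl; ≢-sym)
open import Function.Definitions using (Injective)

record SimpleGraph (V : Set) : Set₁ where
  field
    Adj    : V → V → Set
    sym    : ∀ {u v} → Adj u v → Adj v u
    irrefl : ∀ {v} → ¬ Adj v v
open SimpleGraph public

record FinGraph (n : ℕ) : Set₁ where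
  field
    graph : SimpleGraph (Fin n)
    adj?  : Decidable (Adj graph)
open FinGraph public

degree : ∀ {n} (G : FinGraph n) → Fin n → ℕ
degree {n} G v = count (adj? G v) (allFin n)

Regular : ∀ {n} → FinGraph n → ℕ → Set
Regular {n} G d = ∀ (v : Fin n) → degree G v ≡ d

TriangleFree : ∀ {V} → SimpleGraph V → Set
TriangleFree G = ∀ u v w → Adj G u v → Adj G v w → Adj G u w → ⊥

K : (k : ℕ) → SimpleGraph (Fin k)
K k = record { Adj = λ u v → u ≢ v ; sym = ≢-sym ; irrefl = λ p → p refl }

_⊠_ : ∀ {V W} → SimpleGraph V → SimpleGraph W → SimpleGraph (V × W)
_⊠_ {V} {W} G₁ G₂ = record { Adj = A ; sym = s ; irrefl = i }
  where
  A : V × W → V × W → Set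
  A (u₁ , u₂) (v₁ , v₂) =
      (u₁ ≡ v₁ × Adj G₂ u₂ v₂)
    ⊎ (u₂ ≡ v₂ × Adj G₁ u₁ v₁)
    ⊎ (Adj G₁ u₁ v₁ × Adj G₂ u₂ v₂)
  s : ∀ {x y} → A x y → A y x
  s (inj₁ (refl , a)) = inj₁ (refl , sym G₂ a)
  s (inj₂ (inj₁ (refl , a))) = inj₂ (inj₁ (refl , sym G₁ a))
  s (inj₂ (inj₂ (a , b))) = inj₂ (inj₂ (sym G₁ a , sym G₂ b))
  i : ∀ {x} → ¬ A x x
  i (inj₁ (_ , a)) = irrefl G₂ a
  i (inj₂ (inj₁ (_ , a))) = irrefl G₁ a
  i (inj₂ (inj₂ (a , _))) = irrefl G₁ a

_^⟨_⟩ : ∀ {V} → SimpleGraph V → (k : ℕ) → SimpleGraph (V × Fin k)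
G ^⟨ k ⟩ = G ⊠ K k

-- H contains a subdivision of K_t as a subgraph (K_t is a topological minor of H):
-- t distinct branch vertices; for each pair i < j a path
-- branch i, path i j, branch j in H whose internal vertices are distinct,
-- are not branch vertices, and are disjoint from the internal vertices of other paths.
record TopMinorK {V : Set} (H : SimpleGraph V) (t : ℕ) : Set where
  field
    branch     : Fin t → V
    branch-inj : Injective _≡_ _≡_ branch
    path       : (i j : Fin t) → i < j → List V
    path-adj   : ∀ i j (p : i < j) → Linked (Adj H) (branch i ∷ path i j p ++ branch j ∷ [])
    path-uniq  : ∀ i j (p : i < j) → Unique (path i j p)
    path-avoid : ∀ i j (p : i < j) (l : Fin t) (v : V) → v ∈ path i j p → branch l ≢ v
    disjoint   : ∀ i j (p : i < j) i' j' (p' : i' < j') (v : V) →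
                 v ∈ path i j p → v ∈ path i' j' p' → (i ≡ i' × j ≡ j')

-- Call the G-coordinate of a vertex of G^(k) its column: a column has k
-- vertices and an edge of G^(k) stays in a column or joins adjacent columns.
-- Given a subdivision with branch vertices b_i, three pigeonhole arguments
-- about the routes leaving the b_i show:
--   (1) every b_i has a twin, another branch vertex in the same column;
--   (2) some branch vertex lies in a column adjacent to that of two twins;
--   (3) two pairs of twins never lie in adjacent columns (triangle-freeness).
-- Applying (1), (2) and (1) again yields the configuration excluded by (3).
-- The argument only needs d ≥ 4 and no lower bound on k.
module Submission where

open import Defs
open import Data.Nat using (ℕ; _≤_; _+_; _*_)
open import Relation.Nullary using (¬_)

open import Level using (0ℓ)
open import Data.Bool using (true; false)
open import Data.Empty using (⊥; ⊥-elim)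
open import Data.Nat using (suc; s≤s; z≤n)
import Data.Nat.Properties as ℕP
open import Data.Nat.Tactic.RingSolver using (solve-∀)
open import Data.Fin as F using (Fin; zero; suc)
import Data.Fin.Properties as FP
open import Data.Product using (_×_; _,_; proj₁; proj₂; ∃)
open import Data.Product.Properties using (×-≡,≡→≡; ×-≡,≡←≡)
open import Data.Product.Function.NonDependent.Propositional using (_×-↔_)
open import Data.Sum using (_⊎_; inj₁; inj₂)
open import Data.Sum.Properties using (inj₁-injective; inj₂-injective)
open import Data.List as L using (List; []; _∷_; _++_; length; map; filter; cartesianProductWith)
import Data.List.Properties as LP
open import Data.List.Membership.Propositional using (_∈_)
import Data.List.Membership.Propositional.Properties as MP
open import Data.List.Relation.Unary.Any as Any using (Any; here; there)
import Data.List.Relation.Unary.Any.Properties as AnyP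
open import Data.List.Relation.Unary.Linked using (Linked; []; [-]; _∷_)
open import Data.Vec as V using (Vec; count)
import Data.Vec.Membership.Propositional.Properties as VMP
open import Relation.Nullary using (Dec; does; yes; no)
open import Relation.Nullary.Decidable using (¬?; _×-dec_; _⊎-dec_)
open import Relation.Unary using (Pred; Decidable)
open import Relation.Binary using (Tri; tri<; tri≈; tri>; DecidableEquality)
open import Relation.Binary.PropositionalEquality hiding (sym)
import Relation.Binary.PropositionalEquality as ≡
open import Function.Base using (_∘_)
open import Function.Bundles using (_↣_; Injection)
open import Function.Definitions using (Injective)
open import Function.Construct.Identity using (↣-id; ↔-id)
open import Function.Construct.Composition using (_↔-∘_)
open import Function.Properties.Inverse using (↔⇒↣)

pigeonhole : ∀ {N} {D C : Set} (e : Fin N ↣ D) (f : D → C) → Injective _≡_ _≡_ f →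
             (cs : List C) → (∀ x → f x ∈ cs) → N ≤ length cs
pigeonhole e f f-inj cs covered = ℕP.≮⇒≥ λ short →
  let g = λ i → f (Injection.to e i)
      position = λ i → Any.index (covered (Injection.to e i))
      (i , j , i<j , same) = FP.pigeonhole short position
      g-equal : g i ≡ g j
      g-equal = trans (AnyP.lookup-index (covered _))
                  (trans (cong (L.lookup cs) same) (≡.sym (AnyP.lookup-index (covered _))))
  in FP.<⇒≢ i<j (Injection.injective e (f-inj g-equal))

length-cartesianProductWith : ∀ {A B C : Set} (f : A → B → C) (xs : List A) (ys : List B) →
  length (cartesianProductWith f xs ys) ≡ length xs * length ys
length-cartesianProductWith f [] ys = refl
length-cartesianProductWith f (x ∷ xs) ys = begin
  length (map (f x) ys ++ cartesianProductWith f xs ys)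
    ≡⟨ LP.length-++ (map (f x) ys) ⟩
  length (map (f x) ys) + length (cartesianProductWith f xs ys)
    ≡⟨ cong₂ _+_ (LP.length-map (f x) ys) (length-cartesianProductWith f xs ys) ⟩
  length ys + length xs * length ys ∎
  where open ≡-Reasoning

length-allFin : ∀ m → length (L.allFin m) ≡ m
length-allFin m = LP.length-tabulate (λ i → i)

count≡length-filter : ∀ {A : Set} {P : Pred A 0ℓ} (P? : Decidable P) {m} (xs : Vec A m) →
  count P? xs ≡ length (filter P? (V.toList xs))
count≡length-filter P? V.[] = refl
count≡length-filter P? (x V.∷ xs) with does (P? x)
... | true  = cong suc (count≡length-filter P? xs)
... | false = count≡length-filter P? xs

∈-walk : ∀ {A : Set} {x y u : A} (P : List A) → u ∈ x ∷ P ++ y ∷ [] → u ≡ x ⊎ u ∈ P ⊎ u ≡ y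
∈-walk P (here u≡x) = inj₁ u≡x
∈-walk P (there u∈) with MP.∈-++⁻ P u∈
... | inj₁ u∈P = inj₂ (inj₁ u∈P)
... | inj₂ (here u≡y) = inj₂ (inj₂ u≡y)

∃∈-there : ∀ {A : Set} {P : A → Set} {a xs} → (∃ λ u → u ∈ xs × P u) → ∃ λ u → u ∈ a ∷ xs × P u
∃∈-there (u , m , pu) = u , there m , pu

-- The vertex following x on the walk x ∷ P ++ [y] …
firstOr : ∀ {A : Set} → List A → A → A
firstOr []      y = y
firstOr (u ∷ _) _ = u

-- … and the vertex preceding x on the walk y ∷ P ++ [x].
lastOr : ∀ {A : Set} → List A → A → A
lastOr []      y = y
lastOr (u ∷ P) _ = lastOr P u

module _ {A : Set} {R : A → A → Set} where

  firstOr-linked : ∀ {x y} P → Linked R (x ∷ P ++ y ∷ []) → R x (firstOr P y)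
  firstOr-linked []      (r ∷ _) = r
  firstOr-linked (_ ∷ _) (r ∷ _) = r

  lastOr-linked : ∀ {x y} P → Linked R (y ∷ P ++ x ∷ []) → R (lastOr P y) x
  lastOr-linked []      (r ∷ _)  = r
  lastOr-linked (_ ∷ P) (_ ∷ lk) = lastOr-linked P lk

firstOr-∈ : ∀ {A : Set} (P : List A) y → firstOr P y ∈ P ⊎ firstOr P y ≡ y
firstOr-∈ []      y = inj₂ refl
firstOr-∈ (u ∷ P) y = inj₁ (here refl)

lastOr-∈ : ∀ {A : Set} (P : List A) y → lastOr P y ∈ P ⊎ lastOr P y ≡ y
lastOr-∈ []      y = inj₂ refl
lastOr-∈ (u ∷ P) y with lastOr-∈ P u
... | inj₁ ∈P  = inj₁ (there ∈P)
... | inj₂ ≡u  = inj₁ (here ≡u)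

one-source-overflow : ∀ k d → ¬ k * d + 2 ≤ suc (d * k)
one-source-overflow k d le = ℕP.m+1+n≰m (suc (d * k)) (subst (_≤ suc (d * k)) (eq k d) le)
  where
  eq : ∀ k d → k * d + 2 ≡ suc (d * k) + suc 0
  eq = solve-∀

two-source-overflow : ∀ k d → 2 ≤ d → ¬ 2 * (k * d + 2) ≤ d * k + 2 * k
two-source-overflow k d 2≤d le with ℕP.m≤n⇒∃[o]m+o≡n 2≤d
... | c , refl = ℕP.m+1+n≰m _ (subst (_≤ (2 + c) * k + 2 * k) (eq k c) le)
  where
  eq : ∀ k c → 2 * (k * (2 + c) + 2) ≡ (2 + c) * k + 2 * k + suc (k * c + 3)
  eq = solve-∀

four-source-overflow : ∀ k d → 4 ≤ d → ¬ (2 * 2) * (k * d + 2) ≤ (d + d) * k + (k * d + 2 + (2 * k) * 2)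
four-source-overflow k d 4≤d le with ℕP.m≤n⇒∃[o]m+o≡n 4≤d
... | c , refl = ℕP.m+1+n≰m _ (subst (_≤ (4 + c + (4 + c)) * k + (k * (4 + c) + 2 + (2 * k) * 2)) (eq k c) le)
  where
  eq : ∀ k c → (2 * 2) * (k * (4 + c) + 2) ≡
               (4 + c + (4 + c)) * k + (k * (4 + c) + 2 + (2 * k) * 2) + suc (k * c + 5)
  eq = solve-∀

-- For branch
-- indices i, j the realising path consists of b_i, the segment seg i j of
-- internal vertices, and b_j (in either orientation); seg i i is empty.
module Routing {V : Set} {H : SimpleGraph V} {t : ℕ} (T : TopMinorK H t) where
  open TopMinorK T

  Order : Fin t → Fin t → Set
  Order i j = Tri (i F.< j) (i ≡ j) (j F.< i)

  segmentBy : ∀ i j → Order i j → List V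
  segmentBy i j (tri< i<j _ _) = path i j i<j
  segmentBy i j (tri≈ _ _ _)   = []
  segmentBy i j (tri> _ _ j<i) = path j i j<i

  seg : Fin t → Fin t → List V
  seg i j = segmentBy i j (FP.<-cmp i j)

  seg-avoid : ∀ i j l {u} → u ∈ seg i j → branch l ≢ u
  seg-avoid i j l = avoidBy (FP.<-cmp i j)
    where
    avoidBy : ∀ {u} (c : Order i j) → u ∈ segmentBy i j c → branch l ≢ u
    avoidBy (tri< i<j _ _) = path-avoid i j i<j l _
    avoidBy (tri> _ _ j<i) = path-avoid j i j<i l _

  SameEdge : Fin t → Fin t → Fin t → Fin t → Set
  SameEdge i j i' j' = (i ≡ i' × j ≡ j') ⊎ (i ≡ j' × j ≡ i')

  seg-disjoint : ∀ i j i' j' {u} → u ∈ seg i j → u ∈ seg i' j' → SameEdge i j i' j'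
  seg-disjoint i j i' j' = disjointBy (FP.<-cmp i j) (FP.<-cmp i' j')
    where
    disjointBy : ∀ {u} c c' → u ∈ segmentBy i j c → u ∈ segmentBy i' j' c' → SameEdge i j i' j'
    disjointBy (tri< p _ _) (tri< p' _ _) m m' with disjoint i j p i' j' p' _ m m'
    ... | refl , refl = inj₁ (refl , refl)
    disjointBy (tri< p _ _) (tri> _ _ p') m m' with disjoint i j p j' i' p' _ m m'
    ... | refl , refl = inj₂ (refl , refl)
    disjointBy (tri> _ _ p) (tri< p' _ _) m m' with disjoint j i p i' j' p' _ m m'
    ... | refl , refl = inj₂ (refl , refl)
    disjointBy (tri> _ _ p) (tri> _ _ p') m m' with disjoint j i p j' i' p' _ m m'
    ... | refl , refl = inj₁ (refl , refl)

  Ahead : Fin t → Fin t → V → Set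
  Ahead i j u = u ∈ seg i j ⊎ u ≡ branch j

  ahead-inj : ∀ {i j j' u} → i ≢ j → Ahead i j u → Ahead i j' u → j ≡ j'
  ahead-inj {i} {j} {j'} i≢j (inj₁ m) (inj₁ m') with seg-disjoint i j i j' m m'
  ... | inj₁ (_ , j≡j') = j≡j'
  ... | inj₂ (_ , j≡i)  = ⊥-elim (i≢j (≡.sym j≡i))
  ahead-inj {i} {j} {j'} _ (inj₁ m) (inj₂ e') = ⊥-elim (seg-avoid i j j' m (≡.sym e'))
  ahead-inj {i} {j} {j'} _ (inj₂ e) (inj₁ m') = ⊥-elim (seg-avoid i j' j m' (≡.sym e))
  ahead-inj _ (inj₂ e) (inj₂ e') = branch-inj (trans (≡.sym e) e')

  record WalkVia (x y : V) (P : List V) : Set where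
    field
      vertices : List V
      linked   : Linked (Adj H) vertices
      ∋start   : x ∈ vertices
      ∋end     : y ∈ vertices
      only     : ∀ {u} → u ∈ vertices → u ≡ x ⊎ u ∈ P ⊎ u ≡ y

  route : ∀ i j → WalkVia (branch i) (branch j) (seg i j)
  route i j = routeBy (FP.<-cmp i j)
    where
    ∋last : ∀ {x y : V} P → y ∈ x ∷ P ++ y ∷ []
    ∋last P = there (MP.∈-++⁺ʳ P (here refl))

    routeBy : (c : Order i j) → WalkVia (branch i) (branch j) (segmentBy i j c)
    routeBy (tri< i<j _ _) = record
      { vertices = branch i ∷ path i j i<j ++ branch j ∷ []
      ; linked   = path-adj i j i<j
      ; ∋start   = here refl
      ; ∋end     = ∋last (path i j i<j)
      ; only     = ∈-walk (path i j i<j) }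
    routeBy (tri≈ _ i≡j _) = record
      { vertices = branch i ∷ []
      ; linked   = [-]
      ; ∋start   = here refl
      ; ∋end     = here (cong branch (≡.sym i≡j))
      ; only     = λ { (here e) → inj₁ e } }
    routeBy (tri> _ _ j<i) = record
      { vertices = branch j ∷ path j i j<i ++ branch i ∷ []
      ; linked   = path-adj j i j<i
      ; ∋start   = ∋last (path j i j<i)
      ; ∋end     = here refl
      ; only     = λ m → reverse (∈-walk (path j i j<i) m) }
      where
      reverse : ∀ {u} → u ≡ branch j ⊎ u ∈ path j i j<i ⊎ u ≡ branch i →
                u ≡ branch i ⊎ u ∈ path j i j<i ⊎ u ≡ branch j
      reverse (inj₁ e)        = inj₂ (inj₂ e)
      reverse (inj₂ (inj₁ m)) = inj₂ (inj₁ m)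
      reverse (inj₂ (inj₂ e)) = inj₁ e

  stepBy : ∀ i j → Order i j → V
  stepBy i j (tri< i<j _ _) = firstOr (path i j i<j) (branch j)
  stepBy i j (tri≈ _ _ _)   = branch j
  stepBy i j (tri> _ _ j<i) = lastOr (path j i j<i) (branch j)

  step : Fin t → Fin t → V
  step i j = stepBy i j (FP.<-cmp i j)

  step-adj : ∀ i j → i ≢ j → Adj H (branch i) (step i j)
  step-adj i j i≢j = adjBy (FP.<-cmp i j)
    where
    adjBy : (c : Order i j) → Adj H (branch i) (stepBy i j c)
    adjBy (tri< i<j _ _) = firstOr-linked (path i j i<j) (path-adj i j i<j)
    adjBy (tri≈ _ i≡j _) = ⊥-elim (i≢j i≡j)
    adjBy (tri> _ _ j<i) = SimpleGraph.sym H (lastOr-linked (path j i j<i) (path-adj j i j<i))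

  step-ahead : ∀ i j → Ahead i j (step i j)
  step-ahead i j = aheadBy (FP.<-cmp i j)
    where
    aheadBy : (c : Order i j) → stepBy i j c ∈ segmentBy i j c ⊎ stepBy i j c ≡ branch j
    aheadBy (tri< i<j _ _) = firstOr-∈ (path i j i<j) (branch j)
    aheadBy (tri≈ _ _ _)   = inj₂ refl
    aheadBy (tri> _ _ j<i) = lastOr-∈ (path j i j<i) (branch j)

-- Columns
-- are assumed to have decidable equality, so that walks can be scanned.
module Columns {V W : Set} (_≟_ : DecidableEquality V) (G₁ : SimpleGraph V) (G₂ : SimpleGraph W) where

  private
    H = G₁ ⊠ G₂

  col : V × W → V
  col = proj₁

  col-adj : ∀ {p q} → Adj H p q → col p ≡ col q ⊎ Adj G₁ (col p) (col q)
  col-adj (inj₁ (e , _))        = inj₁ e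
  col-adj (inj₂ (inj₁ (_ , a))) = inj₂ a
  col-adj (inj₂ (inj₂ (a , _))) = inj₂ a

  leave : ∀ {v p q} → Adj H p q → col p ≡ v → col q ≢ v → Adj G₁ v (col q)
  leave a refl q∉v with col-adj a
  ... | inj₁ e = ⊥-elim (q∉v (≡.sym e))
  ... | inj₂ g = g

  crossing : ∀ v ws → Linked (Adj H) ws → Any (λ x → col x ≡ v) ws → Any (λ x → col x ≢ v) ws →
             ∃ λ u → u ∈ ws × col u ≢ v × Adj G₁ v (col u)
  crossing v (a ∷ []) _ (here a∈v) (here a∉v) = ⊥-elim (a∉v a∈v)
  crossing v (a ∷ h ∷ ws) (r ∷ lk) inside outside with col a ≟ v | col h ≟ v
  ... | yes a∈v | no h∉v = h , there (here refl) , h∉v , leave r a∈v h∉v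
  ... | no a∉v  | yes h∈v = a , here refl , a∉v , leave (SimpleGraph.sym H r) h∈v a∉v
  ... | yes a∈v | yes h∈v = ∃∈-there (crossing v (h ∷ ws) lk (here h∈v) (Any.tail (λ a∉v → a∉v a∈v) outside))
  ... | no a∉v  | no h∉v  = ∃∈-there (crossing v (h ∷ ws) lk (Any.tail a∉v inside) (here h∉v))

  common-neighbour : TriangleFree G₁ → ∀ {p q z} → Adj G₁ (col p) (col q) →
                     Adj H p z → Adj H q z → col z ≡ col p ⊎ col z ≡ col q
  common-neighbour tf {p} {q} {z} pq pz qz with col-adj pz | col-adj qz
  ... | inj₁ e  | _       = inj₁ (≡.sym e)
  ... | inj₂ _  | inj₁ e  = inj₂ (≡.sym e)
  ... | inj₂ pz' | inj₂ qz' = ⊥-elim (tf (col p) (col q) (col z) pq qz' pz')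

  module Exits {t} (T : TopMinorK H t) where
    open TopMinorK T
    open Routing T

    record Exit (i j : Fin t) : Set where
      field
        vertex   : V × W
        ahead    : Ahead i j vertex
        moved    : col vertex ≢ col (branch i)
        adjacent : Adj G₁ (col (branch i)) (col vertex)

    exit : ∀ i j → col (branch j) ≢ col (branch i) → Exit i j
    exit i j j∉ with crossing (col (branch i)) vertices linked
                       (Any.map (λ e → cong col (≡.sym e)) ∋start)
                       (Any.map (λ e c → j∉ (trans (cong col e) c)) ∋end)
      where open WalkVia (route i j)
    ... | u , m , u∉ , g with WalkVia.only (route i j) m
    ...   | inj₁ u≡bi  = ⊥-elim (u∉ (cong col u≡bi))
    ...   | inj₂ ahead = record { vertex = u ; ahead = ahead ; moved = u∉ ; adjacent = g }

module Counting {n} (G : FinGraph n) (d k : ℕ) (reg : Regular G d)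
                (T : TopMinorK (graph G ^⟨ k ⟩) (k * d + 2)) where
  open TopMinorK T
  open Routing T
  open Columns F._≟_ (graph G) (K k)
  open Exits T
  open Exit

  t : ℕ
  t = k * d + 2

  Vtx : Set
  Vtx = Fin n × Fin k

  b : Fin t → Vtx
  b = branch

  nbrs : Fin n → List (Fin n)
  nbrs v = filter (adj? G v) (V.toList (V.allFin n))

  length-nbrs : ∀ v → length (nbrs v) ≡ d
  length-nbrs v = trans (≡.sym (count≡length-filter (adj? G v) (V.allFin n))) (reg v)

  ∈-nbrs : ∀ {v w} → Adj (graph G) v w → w ∈ nbrs v
  ∈-nbrs {v} {w} g = MP.∈-filter⁺ (adj? G v) (VMP.∈-toList⁺ (VMP.∈-allFin⁺ w)) g

  layers : List (Fin n) → List Vtx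
  layers cs = cartesianProductWith _,_ cs (L.allFin k)

  length-layers : ∀ cs → length (layers cs) ≡ length cs * k
  length-layers cs = trans (length-cartesianProductWith _,_ cs (L.allFin k))
                           (cong (length cs *_) (length-allFin k))

  ∈-layers : ∀ {cs} z → col z ∈ cs → z ∈ layers cs
  ∈-layers (c , a) c∈ = MP.∈-cartesianProductWith⁺ _,_ c∈ (MP.∈-allFin a)

  -- (1) Every branch vertex b_i shares its column with another branch
  -- vertex.  Otherwise the routes from b_i to the other t − 1 branch
  -- vertices leave the column v of b_i through distinct vertices of the
  -- d·k vertices in columns adjacent to v.
  module Lonely (i : Fin t) (lonely : ∀ j → j ≢ i → col (b j) ≢ col (b i)) where
    exitTo : ∀ j → j ≢ i → Exit i j
    exitTo j j≢i = exit i j (lonely j j≢i)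

    escape : ∀ j → Dec (j ≡ i) → Vtx
    escape j (yes _)  = b i
    escape j (no j≢i) = vertex (exitTo j j≢i)

    escape-inj : ∀ j j' dj dj' → escape j dj ≡ escape j' dj' → j ≡ j'
    escape-inj j j' (yes j≡i) (yes j'≡i) _ = trans j≡i (≡.sym j'≡i)
    escape-inj j j' (yes _) (no j'≢i) e = ⊥-elim (moved (exitTo j' j'≢i) (cong col (≡.sym e)))
    escape-inj j j' (no j≢i) (yes _) e  = ⊥-elim (moved (exitTo j j≢i) (cong col e))
    escape-inj j j' (no j≢i) (no j'≢i) e =
      ahead-inj (λ i≡j → j≢i (≡.sym i≡j)) (ahead (exitTo j j≢i))
                (subst (Ahead i j') (≡.sym e) (ahead (exitTo j' j'≢i)))

    targets : List Vtx
    targets = b i ∷ layers (nbrs (col (b i)))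

    escape-∈ : ∀ j dj → escape j dj ∈ targets
    escape-∈ j (yes _)  = here refl
    escape-∈ j (no j≢i) = there (∈-layers _ (∈-nbrs (adjacent (exitTo j j≢i))))

    overflow : ⊥
    overflow = one-source-overflow k d (subst (t ≤_) size
      (pigeonhole (↣-id _) (λ j → escape j (j F.≟ i))
                  (λ {j} {j'} → escape-inj j j' (j F.≟ i) (j' F.≟ i))
                  targets (λ j → escape-∈ j (j F.≟ i))))
      where
      size : length targets ≡ suc (d * k)
      size = cong suc (trans (length-layers (nbrs (col (b i)))) (cong (_* k) (length-nbrs _)))

  twin : ∀ i → ∃ λ j → j ≢ i × col (b j) ≡ col (b i)
  twin i with FP.any? (λ j → ¬? (j F.≟ i) ×-dec (col (b j) F.≟ col (b i)))
  ... | yes found = found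
  ... | no none   = ⊥-elim (Lonely.overflow i (λ j j≢i same → none (j , j≢i , same)))

  -- (2) If b_i₁ and b_i₂ share the column v, some branch vertex lies in a
  -- column adjacent to v.  Otherwise every route from b_i₁ or b_i₂ to a
  -- branch vertex outside v leaves v through an internal vertex next to v;
  -- together with the ≤ k branch vertices inside v (counted twice) this
  -- places 2·t objects into d·k + 2·k slots.
  module Isolated (i₁ i₂ : Fin t) (i₂≢i₁ : i₂ ≢ i₁) (same : col (b i₂) ≡ col (b i₁))
                  (isolated : ∀ j → ¬ Adj (graph G) (col (b i₁)) (col (b j))) where
    v : Fin n
    v = col (b i₁)

    source : Fin 2 → Fin t
    source zero       = i₁
    source (suc zero) = i₂

    source-col : ∀ κ → col (b (source κ)) ≡ v
    source-col zero       = refl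
    source-col (suc zero) = same

    source-inj : ∀ κ κ' → source κ ≡ source κ' → κ ≡ κ'
    source-inj zero       zero       _ = refl
    source-inj (suc zero) (suc zero) _ = refl
    source-inj zero       (suc zero) e = ⊥-elim (i₂≢i₁ (≡.sym e))
    source-inj (suc zero) zero       e = ⊥-elim (i₂≢i₁ e)

    exitTo : ∀ κ j → col (b j) ≢ v → Exit (source κ) j
    exitTo κ j j∉v = exit (source κ) j (λ e → j∉v (trans e (source-col κ)))

    exit-adjacent : ∀ κ j j∉v → Adj (graph G) v (col (vertex (exitTo κ j j∉v)))
    exit-adjacent κ j j∉v = subst (λ c → Adj (graph G) c (col (vertex e))) (source-col κ) (adjacent e)
      where e = exitTo κ j j∉v

    -- As no branch vertex is next to v, the exit vertex is internal.
    exit-internal : ∀ κ j j∉v → vertex (exitTo κ j j∉v) ∈ seg (source κ) j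
    exit-internal κ j j∉v with ahead (exitTo κ j j∉v)
    ... | inj₁ internal = internal
    ... | inj₂ ≡bj = ⊥-elim (isolated j (subst (λ z → Adj (graph G) v (col z)) ≡bj (exit-adjacent κ j j∉v)))

    Slot : Set
    Slot = Vtx ⊎ (Fin 2 × Fin k)

    slotFor : ∀ κ j → Dec (col (b j) ≡ v) → Slot
    slotFor κ j (yes _)   = inj₂ (κ , proj₂ (b j))
    slotFor κ j (no j∉v)  = inj₁ (vertex (exitTo κ j j∉v))

    slot : Fin 2 × Fin t → Slot
    slot (κ , j) = slotFor κ j (col (b j) F.≟ v)

    slotFor-inj : ∀ κ j κ' j' dj dj' → slotFor κ j dj ≡ slotFor κ' j' dj' → (κ , j) ≡ (κ' , j')
    slotFor-inj κ j κ' j' (yes j∈v) (yes j'∈v) e with ×-≡,≡←≡ (inj₂-injective e)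
    ... | refl , same-level = cong (κ ,_) (branch-inj (×-≡,≡→≡ (trans j∈v (≡.sym j'∈v) , same-level)))
    slotFor-inj κ j κ' j' (no j∉v) (no j'∉v) e
      with seg-disjoint (source κ) j (source κ') j' (exit-internal κ j j∉v)
             (subst (_∈ seg (source κ') j') (≡.sym (inj₁-injective e)) (exit-internal κ' j' j'∉v))
    ... | inj₁ (κ-same , refl) = cong (_, j) (source-inj κ κ' κ-same)
    ... | inj₂ (_ , j≡src) = ⊥-elim (j∉v (trans (cong (col ∘ b) j≡src) (source-col κ')))

    levels : List (Fin 2 × Fin k)
    levels = cartesianProductWith _,_ (L.allFin 2) (L.allFin k)

    targets : List Slot
    targets = map inj₁ (layers (nbrs v)) ++ map inj₂ levels

    slotFor-∈ : ∀ κ j dj → slotFor κ j dj ∈ targets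
    slotFor-∈ κ j (yes _) = MP.∈-++⁺ʳ (map inj₁ (layers (nbrs v)))
      (MP.∈-map⁺ inj₂ (MP.∈-cartesianProductWith⁺ _,_ (MP.∈-allFin κ) (MP.∈-allFin _)))
    slotFor-∈ κ j (no j∉v) = MP.∈-++⁺ˡ (MP.∈-map⁺ inj₁ (∈-layers _ (∈-nbrs (exit-adjacent κ j j∉v))))

    size : length targets ≡ d * k + 2 * k
    size = begin
      length targets
        ≡⟨ LP.length-++ (map inj₁ (layers (nbrs v))) ⟩
      length (map inj₁ (layers (nbrs v))) + length (map inj₂ levels)
        ≡⟨ cong₂ _+_ (LP.length-map inj₁ (layers (nbrs v))) (LP.length-map inj₂ levels) ⟩
      length (layers (nbrs v)) + length levels
        ≡⟨ cong₂ _+_ (trans (length-layers (nbrs v)) (cong (_* k) (length-nbrs v)))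
                     (trans (length-cartesianProductWith _,_ (L.allFin 2) (L.allFin k))
                            (cong₂ _*_ (length-allFin 2) (length-allFin k))) ⟩
      d * k + 2 * k ∎
      where open ≡-Reasoning

    overflow : 2 ≤ d → ⊥
    overflow 2≤d = two-source-overflow k d 2≤d (subst (2 * t ≤_) size
      (pigeonhole (↔⇒↣ FP.*↔×) slot
                  (λ {x} {y} → slotFor-inj _ _ _ _ (col (b (proj₂ x)) F.≟ v) (col (b (proj₂ y)) F.≟ v))
                  targets (λ (κ , j) → slotFor-∈ κ j (col (b j) F.≟ v))))

  adjacentBranch : 2 ≤ d → ∀ i₁ i₂ → i₂ ≢ i₁ → col (b i₂) ≡ col (b i₁) →
                   ∃ λ l → Adj (graph G) (col (b i₁)) (col (b l))
  adjacentBranch 2≤d i₁ i₂ i₂≢i₁ same with FP.any? (λ l → adj? G (col (b i₁)) (col (b l)))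
  ... | yes found = found
  ... | no none   = ⊥-elim (Isolated.overflow i₁ i₂ i₂≢i₁ same (λ l g → none (l , g)) 2≤d)

  -- (3) No two pairs of twins lie in adjacent columns v ~ w.  Each of the
  -- four twins b_s sends, for every branch index j, an object to a slot:
  -- the first vertex after b_s on the route to b_j when it is internal
  -- (these lie in the 2·d·k vertices of columns next to v or w and are all
  -- distinct), and otherwise one of the t branch slots or 4·k extra slots
  -- attached to the vertices of columns v and w.  By triangle-freeness a
  -- branch vertex off these columns is adjacent to twins of one side only,
  -- so 4·t objects are placed injectively into 2·d·k + t + 4·k slots.
  module AdjacentTwins (tf : TriangleFree (graph G))
                       (i₁ i₂ : Fin t) (i₂≢i₁ : i₂ ≢ i₁) (same₁₂ : col (b i₂) ≡ col (b i₁))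
                       (i₃ i₄ : Fin t) (i₄≢i₃ : i₄ ≢ i₃) (same₃₄ : col (b i₄) ≡ col (b i₃))
                       (v~w : Adj (graph G) (col (b i₁)) (col (b i₃))) where
    v w : Fin n
    v = col (b i₁)
    w = col (b i₃)

    -- Side σ of the edge vw and the two twins κ on that side.
    column : Fin 2 → Fin n
    column zero       = v
    column (suc zero) = w

    source : Fin 2 → Fin 2 → Fin t
    source zero       zero       = i₁
    source zero       (suc zero) = i₂
    source (suc zero) zero       = i₃
    source (suc zero) (suc zero) = i₄

    source-col : ∀ σ κ → col (b (source σ κ)) ≡ column σ
    source-col zero       zero       = refl
    source-col zero       (suc zero) = same₁₂
    source-col (suc zero) zero       = refl
    source-col (suc zero) (suc zero) = same₃₄

    column-inj : ∀ σ σ' → column σ ≡ column σ' → σ ≡ σ'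
    column-inj zero       zero       _   = refl
    column-inj (suc zero) (suc zero) _   = refl
    column-inj zero       (suc zero) v≡w = ⊥-elim (SimpleGraph.irrefl (graph G) (subst (Adj (graph G) v) (≡.sym v≡w) v~w))
    column-inj (suc zero) zero       w≡v = ⊥-elim (SimpleGraph.irrefl (graph G) (subst (Adj (graph G) v) w≡v v~w))

    twins-distinct : ∀ σ → source σ (suc zero) ≢ source σ zero
    twins-distinct zero       = i₂≢i₁
    twins-distinct (suc zero) = i₄≢i₃

    source-inj : ∀ σ κ σ' κ' → source σ κ ≡ source σ' κ' → (σ , κ) ≡ (σ' , κ')
    source-inj σ κ σ' κ' e
      with column-inj σ σ' (trans (≡.sym (source-col σ κ)) (trans (cong (col ∘ b) e) (source-col σ' κ')))
    ... | refl = cong (σ ,_) (twin-inj κ κ' e)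
      where
      twin-inj : ∀ κ κ' → source σ κ ≡ source σ κ' → κ ≡ κ'
      twin-inj zero       zero       _ = refl
      twin-inj (suc zero) (suc zero) _ = refl
      twin-inj zero       (suc zero) e = ⊥-elim (twins-distinct σ (≡.sym e))
      twin-inj (suc zero) zero       e = ⊥-elim (twins-distinct σ e)

    OnColumns : Vtx → Set
    OnColumns z = col z ≡ v ⊎ col z ≡ w

    onColumns? : ∀ z → Dec (OnColumns z)
    onColumns? z = (col z F.≟ v) ⊎-dec (col z F.≟ w)

    source-on : ∀ σ κ → OnColumns (b (source σ κ))
    source-on zero       κ = inj₁ (source-col zero κ)
    source-on (suc zero) κ = inj₂ (source-col (suc zero) κ)

    source≢off : ∀ σ κ j → ¬ OnColumns (b j) → source σ κ ≢ j
    source≢off σ κ j off refl = off (source-on σ κ)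

    -- Columns v, w and their neighbours: all columns next to a twin.
    near : List (Fin n)
    near = nbrs v ++ nbrs w

    on-near : ∀ z → OnColumns z → col z ∈ near
    on-near z (inj₁ refl) = MP.∈-++⁺ʳ (nbrs v) (∈-nbrs (SimpleGraph.sym (graph G) v~w))
    on-near z (inj₂ refl) = MP.∈-++⁺ˡ (∈-nbrs v~w)

    neighbour-near : ∀ {p} z → OnColumns p → Adj (graph G ^⟨ k ⟩) p z → col z ∈ near
    neighbour-near {p} z p-on a with col-adj a | p-on
    ... | inj₁ p≡z | _ = on-near z (subst (λ c → c ≡ v ⊎ c ≡ w) p≡z p-on)
    ... | inj₂ g | inj₁ refl = MP.∈-++⁺ˡ (∈-nbrs g)
    ... | inj₂ g | inj₂ refl = MP.∈-++⁺ʳ (nbrs v) (∈-nbrs g)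

    data Reason (σ κ : Fin 2) (j : Fin t) : Set where
      onColumns  : OnColumns (b j) → Reason σ κ j
      viaSegment : ¬ OnColumns (b j) → step (source σ κ) j ∈ seg (source σ κ) j → Reason σ κ j
      direct     : ¬ OnColumns (b j) → step (source σ κ) j ≡ b j → Reason σ κ j

    reason : ∀ σ κ j → Reason σ κ j
    reason σ κ j with onColumns? (b j)
    ... | yes on = onColumns on
    ... | no off with step-ahead (source σ κ) j
    ...   | inj₁ internal = viaSegment off internal
    ...   | inj₂ ≡bj      = direct off ≡bj

    direct-adj : ∀ σ κ j → ¬ OnColumns (b j) → step (source σ κ) j ≡ b j →
                 Adj (graph G ^⟨ k ⟩) (b (source σ κ)) (b j)
    direct-adj σ κ j off ≡bj = subst (Adj (graph G ^⟨ k ⟩) _) ≡bj (step-adj _ _ (source≢off σ κ j off))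

    one-side : ∀ σ κ σ' κ' j → ¬ OnColumns (b j) → Adj (graph G ^⟨ k ⟩) (b (source σ κ)) (b j) →
               Adj (graph G ^⟨ k ⟩) (b (source σ' κ')) (b j) → σ ≡ σ'
    one-side zero       _ zero       _ _ _ _ _ = refl
    one-side (suc zero) _ (suc zero) _ _ _ _ _ = refl
    one-side zero κ (suc zero) κ' j off a a' with common-neighbour tf (subst₂ (Adj (graph G))
        (≡.sym (source-col zero κ)) (≡.sym (source-col (suc zero) κ')) v~w) a a'
    ... | inj₁ e = ⊥-elim (off (inj₁ (trans e (source-col zero κ))))
    ... | inj₂ e = ⊥-elim (off (inj₂ (trans e (source-col (suc zero) κ'))))
    one-side (suc zero) κ zero κ' j off a a' = ≡.sym (one-side zero κ' (suc zero) κ j off a' a)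

    data Slot : Set where
      vertexSlot : Vtx → Slot
      branchSlot : Fin t → Slot
      extraSlot  : Vtx → Fin 2 → Slot

    copySlot : Fin 2 → Fin t → Slot
    copySlot zero       j = vertexSlot (b j)
    copySlot (suc zero) j = branchSlot j

    vertexSlot-injective : ∀ {x y} → vertexSlot x ≡ vertexSlot y → x ≡ y
    vertexSlot-injective refl = refl

    extraSlot-injective : ∀ {x a y c} → extraSlot x a ≡ extraSlot y c → x ≡ y × a ≡ c
    extraSlot-injective refl = refl , refl

    copySlot-inj : ∀ κ j κ' j' → copySlot κ j ≡ copySlot κ' j' → (κ , j) ≡ (κ' , j')
    copySlot-inj zero       j zero       j' e    = cong (zero ,_) (branch-inj (vertexSlot-injective e))
    copySlot-inj (suc zero) j (suc zero) j' refl = refl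
    copySlot-inj zero       j (suc zero) j' ()
    copySlot-inj (suc zero) j zero       j' ()

    copySlot-vertex : ∀ κ j {u} → copySlot κ j ≡ vertexSlot u → b j ≡ u
    copySlot-vertex zero       j refl = refl
    copySlot-vertex (suc zero) j ()

    copySlot≢extra : ∀ κ j {z κ'} → copySlot κ j ≢ extraSlot z κ'
    copySlot≢extra zero       j ()
    copySlot≢extra (suc zero) j ()

    columnSlot : Fin 2 → Fin 2 → Fin t → Slot
    columnSlot zero       κ j = copySlot κ j
    columnSlot (suc zero) κ j = extraSlot (b j) κ

    slotOf : ∀ {σ κ j} → Reason σ κ j → Slot
    slotOf {σ} {κ} {j} (onColumns _)    = columnSlot σ κ j
    slotOf {σ} {κ} {j} (viaSegment _ _) = vertexSlot (step (source σ κ) j)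
    slotOf {σ} {κ} {j} (direct _ _)     = copySlot κ j

    slot : (Fin 2 × Fin 2) × Fin t → Slot
    slot ((σ , κ) , j) = slotOf (reason σ κ j)

    columnSlot-inj : ∀ σ κ j σ' κ' j' → columnSlot σ κ j ≡ columnSlot σ' κ' j' → ((σ , κ) , j) ≡ ((σ' , κ') , j')
    columnSlot-inj zero κ j zero κ' j' e with copySlot-inj κ j κ' j' e
    ... | refl = refl
    columnSlot-inj (suc zero) κ j (suc zero) κ' j' e with extraSlot-injective e
    ... | bj≡bj' , refl with branch-inj bj≡bj'
    ...   | refl = refl
    columnSlot-inj zero       κ j (suc zero) κ' j' e = ⊥-elim (copySlot≢extra κ j e)
    columnSlot-inj (suc zero) κ j zero       κ' j' e = ⊥-elim (copySlot≢extra κ' j' (≡.sym e))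

    -- Internal first steps are distinct, as segments are internally disjoint.
    viaSegment-inj : ∀ σ κ j σ' κ' j' off m off' m' →
      slotOf {σ} {κ} {j} (viaSegment off m) ≡ slotOf {σ'} {κ'} {j'} (viaSegment off' m') →
      ((σ , κ) , j) ≡ ((σ' , κ') , j')
    viaSegment-inj σ κ j σ' κ' j' off m off' m' e
      with seg-disjoint (source σ κ) j (source σ' κ') j' m
             (subst (_∈ seg (source σ' κ') j') (≡.sym (vertexSlot-injective e)) m')
    ... | inj₁ (same-source , refl) = cong (_, j) (source-inj σ κ σ' κ' same-source)
    ... | inj₂ (_ , refl)           = ⊥-elim (off (source-on σ' κ'))

    -- Copy slots of off-column branch vertices are claimed from one side only.
    direct-inj : ∀ σ κ j σ' κ' j' off e off' e' →
      slotOf {σ} {κ} {j} (direct off e) ≡ slotOf {σ'} {κ'} {j'} (direct off' e') →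
      ((σ , κ) , j) ≡ ((σ' , κ') , j')
    direct-inj σ κ j σ' κ' j' off e off' e' same with copySlot-inj κ j κ' j' same
    ... | refl with one-side σ κ σ' κ j off (direct-adj σ κ j off e) (direct-adj σ' κ j off' e')
    ...   | refl = refl

    onColumns≢viaSegment : ∀ σ κ j σ' κ' j' on off' m' →
      slotOf {σ} {κ} {j} (onColumns on) ≢ slotOf {σ'} {κ'} {j'} (viaSegment off' m')
    onColumns≢viaSegment zero κ j σ' κ' j' _ _ m' e =
      seg-avoid (source σ' κ') j' j m' (copySlot-vertex κ j e)
    onColumns≢viaSegment (suc zero) _ _ _ _ _ _ _ _ ()

    onColumns≢direct : ∀ σ κ j σ' κ' j' on off' e' →
      slotOf {σ} {κ} {j} (onColumns on) ≢ slotOf {σ'} {κ'} {j'} (direct off' e')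
    onColumns≢direct zero κ j σ' κ' j' on off' _ e with copySlot-inj κ j κ' j' e
    ... | refl = off' on
    onColumns≢direct (suc zero) κ j σ' κ' j' _ _ _ e = copySlot≢extra κ' j' (≡.sym e)

    viaSegment≢direct : ∀ σ κ j σ' κ' j' off m off' e' →
      slotOf {σ} {κ} {j} (viaSegment off m) ≢ slotOf {σ'} {κ'} {j'} (direct off' e')
    viaSegment≢direct σ κ j σ' κ' j' _ m _ _ e =
      seg-avoid (source σ κ) j j' m (copySlot-vertex κ' j' (≡.sym e))

    slotOf-inj : ∀ {σ κ j σ' κ' j'} (r : Reason σ κ j) (r' : Reason σ' κ' j') →
                 slotOf r ≡ slotOf r' → ((σ , κ) , j) ≡ ((σ' , κ') , j')
    slotOf-inj {σ} {κ} {j} {σ'} {κ'} {j'} = by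
      where
      by : (r : Reason σ κ j) (r' : Reason σ' κ' j') → slotOf r ≡ slotOf r' → ((σ , κ) , j) ≡ ((σ' , κ') , j')
      by (onColumns _)    (onColumns _)      = columnSlot-inj σ κ j σ' κ' j'
      by (viaSegment o m) (viaSegment o' m') = viaSegment-inj σ κ j σ' κ' j' o m o' m'
      by (direct o e)     (direct o' e')     = direct-inj σ κ j σ' κ' j' o e o' e'
      by (onColumns on)   (viaSegment o' m') s = ⊥-elim (onColumns≢viaSegment σ κ j σ' κ' j' on o' m' s)
      by (viaSegment o m) (onColumns on')    s = ⊥-elim (onColumns≢viaSegment σ' κ' j' σ κ j on' o m (≡.sym s))
      by (onColumns on)   (direct o' e')     s = ⊥-elim (onColumns≢direct σ κ j σ' κ' j' on o' e' s)
      by (direct o e)     (onColumns on')    s = ⊥-elim (onColumns≢direct σ' κ' j' σ κ j on' o e (≡.sym s))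
      by (viaSegment o m) (direct o' e')     s = ⊥-elim (viaSegment≢direct σ κ j σ' κ' j' o m o' e' s)
      by (direct o e)     (viaSegment o' m') s = ⊥-elim (viaSegment≢direct σ' κ' j' σ κ j o' m' o e (≡.sym s))

    extras : List Slot
    extras = cartesianProductWith extraSlot (layers (v ∷ w ∷ [])) (L.allFin 2)

    targets : List Slot
    targets = map vertexSlot (layers near) ++ (map branchSlot (L.allFin t) ++ extras)

    vertexSlot-∈ : ∀ z → col z ∈ near → vertexSlot z ∈ targets
    vertexSlot-∈ z c∈ = MP.∈-++⁺ˡ (MP.∈-map⁺ vertexSlot (∈-layers z c∈))

    copySlot-∈ : ∀ κ j → col (b j) ∈ near → copySlot κ j ∈ targets
    copySlot-∈ zero       j c∈ = vertexSlot-∈ (b j) c∈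
    copySlot-∈ (suc zero) j _  = MP.∈-++⁺ʳ (map vertexSlot (layers near))
                                   (MP.∈-++⁺ˡ (MP.∈-map⁺ branchSlot (MP.∈-allFin j)))

    extraSlot-∈ : ∀ z κ → OnColumns z → extraSlot z κ ∈ targets
    extraSlot-∈ z κ on = MP.∈-++⁺ʳ (map vertexSlot (layers near)) (MP.∈-++⁺ʳ (map branchSlot (L.allFin t))
      (MP.∈-cartesianProductWith⁺ extraSlot (∈-layers z (either on)) (MP.∈-allFin κ)))
      where
      either : OnColumns z → col z ∈ v ∷ w ∷ []
      either (inj₁ e) = here e
      either (inj₂ e) = there (here e)

    slotOf-∈ : ∀ {σ κ j} (r : Reason σ κ j) → slotOf r ∈ targets
    slotOf-∈ {zero}     {κ} {j} (onColumns on) = copySlot-∈ κ j (on-near (b j) on)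
    slotOf-∈ {suc zero} {κ} {j} (onColumns on) = extraSlot-∈ (b j) κ on
    slotOf-∈ {σ} {κ} {j} (viaSegment off _) =
      vertexSlot-∈ _ (neighbour-near _ (source-on σ κ) (step-adj _ _ (source≢off σ κ j off)))
    slotOf-∈ {σ} {κ} {j} (direct off ≡bj) =
      copySlot-∈ κ j (neighbour-near _ (source-on σ κ) (direct-adj σ κ j off ≡bj))

    size : length targets ≡ (d + d) * k + (t + (2 * k) * 2)
    size = begin
      length targets
        ≡⟨ LP.length-++ (map vertexSlot (layers near)) ⟩
      length (map vertexSlot (layers near)) + length (map branchSlot (L.allFin t) ++ extras)
        ≡⟨ cong₂ _+_ (LP.length-map vertexSlot (layers near)) (LP.length-++ (map branchSlot (L.allFin t))) ⟩
      length (layers near) + (length (map branchSlot (L.allFin t)) + length extras)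
        ≡⟨ cong₂ _+_ (trans (length-layers near) (cong (_* k) near-size))
                     (cong₂ _+_ (trans (LP.length-map branchSlot (L.allFin t)) (length-allFin t)) extras-size) ⟩
      (d + d) * k + (t + (2 * k) * 2) ∎
      where
      open ≡-Reasoning
      near-size : length near ≡ d + d
      near-size = trans (LP.length-++ (nbrs v)) (cong₂ _+_ (length-nbrs v) (length-nbrs w))
      extras-size : length extras ≡ (2 * k) * 2
      extras-size = trans (length-cartesianProductWith extraSlot (layers (v ∷ w ∷ [])) (L.allFin 2))
                          (cong₂ _*_ (length-layers (v ∷ w ∷ [])) (length-allFin 2))

    overflow : 4 ≤ d → ⊥
    overflow 4≤d = four-source-overflow k d 4≤d (subst ((2 * 2) * t ≤_) size
      (pigeonhole (↔⇒↣ ((FP.*↔× ×-↔ ↔-id _) ↔-∘ FP.*↔×)) slot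
                  (λ { {(σ , κ) , j} {(σ' , κ') , j'} → slotOf-inj (reason σ κ j) (reason σ' κ' j') })
                  targets (λ { ((σ , κ) , j) → slotOf-∈ (reason σ κ j) })))

lemma3p8 : ∀ {n} (G : FinGraph n) (d k : ℕ) → TriangleFree (graph G) → Regular G d → 7 ≤ d → 2 ≤ k →
    ¬ TopMinorK (graph G ^⟨ k ⟩) (k * d + 2)
lemma3p8 G d k tf reg 7≤d _ T =
  let (i₂ , i₂≢i₁ , same₁₂) = twin i₁
      (i₃ , v~w)            = adjacentBranch 2≤d i₁ i₂ i₂≢i₁ same₁₂
      (i₄ , i₄≢i₃ , same₃₄) = twin i₃
  in AdjacentTwins.overflow tf i₁ i₂ i₂≢i₁ same₁₂ i₃ i₄ i₄≢i₃ same₃₄ v~w 4≤d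
  where
  open Counting G d k reg T

  i₁ : Fin t
  i₁ = F.fromℕ< (ℕP.≤-trans (s≤s z≤n) (ℕP.m≤n+m 2 (k * d)))

  2≤d : 2 ≤ d
  2≤d = ℕP.≤-trans (ℕP.m≤m+n 2 5) 7≤d

  4≤d : 4 ≤ d
  4≤d = ℕP.≤-trans (ℕP.m≤m+n 4 3) 7≤d
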